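{- Let $\lambda\leq\Omega$ be a limit ordinal and let $\mathfrak F'=(f_\eta)_{\eta<\lambda}$ be a sequence of functions with properties (1)–(3) of the context. If $(\eta'_n)_{n<\omega}$ is a strictly increasing sequence of ordinals $<\lambda$ with $\sup_{n<\omega}\eta'_n\neq\lambda$, then $\bigcap_{n<\omega}Vf_{\eta'_n}=\emptyset$.
   Context: $\Omega=\omega_1$. Each $f_\eta$ is a strictly increasing function from the positive integers $\{1,2,3,\dots\}$ to the positive integers; $Vf$ denotes the range of $f$, and $f^2=f\circ f$. For ordinals $\alpha<\beta<\lambda$, write $\alpha\to\beta$ if $Vf_\zeta\subseteq Vf_\alpha$ for all $\zeta$ with $\alpha<\zeta\leq\beta$. Properties, for all $\eta<\lambda$: (1) $f_0(x)=2^x$. (2) If $\eta=\eta'+1$ then $f_\eta=f_{\eta'}^2$. (3) If $\eta$ is a limit ordinal, then $\eta$ is assigned a strictly increasing sequence $(\eta_x)_{x<\omega}$ with supremum $\eta$, such that $\eta_x+1\to\eta_{x+1}$ for all $x<\omega$, and $f_\eta(x)=f_{\eta_x}(1)$ for all $x\geq1$. -}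

module Defs where

open import Data.Nat using (ℕ; zero; suc; _^_; _≤_; _<_)
open import Data.Product using (Σ; _×_; ∃; ∃-syntax)
open import Data.Sum using (_⊎_)
open import Relation.Nullary using (¬_)
open import Relation.Binary.PropositionalEquality using (_≡_)
open import Relation.Binary.Definitions using (Trichotomous)
open import Induction.WellFounded using (WellFounded)

-- Functions from the positive integers to the positive integers are
-- represented as functions ℕ → ℕ; only arguments x ≥ 1 matter.

Range : (ℕ → ℕ) → ℕ → Set
Range f y = Σ ℕ (λ x → 1 ≤ x × f x ≡ y)

_⊆V_ : (ℕ → ℕ) → (ℕ → ℕ) → Set
f ⊆V g = ∀ y → Range f y → Range g y

PosStrictIncr : (ℕ → ℕ) → Set
PosStrictIncr f = (∀ x → 1 ≤ x → 1 ≤ f x) × (∀ x y → 1 ≤ x → x < y → f x < f y)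

-- The ordinals below λ are modelled by a type I with a strict order _≺_.

module Ord {I : Set} (_≺_ : I → I → Set) where

  _≼_ : I → I → Set
  a ≼ b = a ≺ b ⊎ a ≡ b

  -- I (with _≺_) is a well-order of a limit order type λ ≤ Ω = ω₁:
  -- strict total, well-founded, no largest element, and every proper
  -- initial segment {β | β ≺ α} is countable.
  IsLimitOrdinalBelowΩ : Set
  IsLimitOrdinalBelowΩ =
    Trichotomous _≡_ _≺_ ×
    WellFounded _≺_ ×
    (∀ α → ∃[ β ] (α ≺ β)) ×
    (∀ α → Σ (Σ I (λ β → β ≺ α) → ℕ) Injective′)
    where
      Injective′ : ∀ {α} → (Σ I (λ β → β ≺ α) → ℕ) → Set
      Injective′ h = ∀ p q → h p ≡ h q → p ≡ q

  IsZero : I → Set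
  IsZero α = ∀ β → ¬ (β ≺ α)

  IsSucc : I → I → Set
  IsSucc α β = α ≺ β × (∀ γ → α ≺ γ → β ≼ γ)

  IsLimit : I → Set
  IsLimit η = ¬ IsZero η × (∀ α → ¬ IsSucc α η)

  Arrow : (I → ℕ → ℕ) → I → I → Set
  Arrow f α β = α ≺ β × (∀ ζ → α ≺ ζ → ζ ≼ β → f ζ ⊆V f α)

  IsFundSeq : I → (ℕ → I) → Set
  IsFundSeq η s =
    (∀ x → s x ≺ s (suc x)) ×
    (∀ x → s x ≺ η) ×
    (∀ β → β ≺ η → ∃[ x ] (β ≺ s x))

  Properties : (I → ℕ → ℕ) → Set
  Properties f =
    (∀ η → PosStrictIncr (f η)) ×
    (∀ η → IsZero η → ∀ x → 1 ≤ x → f η x ≡ 2 ^ x) ×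
    (∀ η η′ → IsSucc η′ η → ∀ x → 1 ≤ x → f η x ≡ f η′ (f η′ x)) ×
    (∀ η → IsLimit η → Σ (ℕ → I) λ s →
        IsFundSeq η s ×
        (∀ x → ∀ t → IsSucc (s x) t → Arrow f t (s (suc x))) ×
        (∀ x → 1 ≤ x → f η x ≡ f (s x) 1))

-- Since the claim is a negation we may argue classically: least elements,
-- successors and the zero/successor/limit trichotomy exist under double
-- negation (module WellOrder), and are only used towards ⊥ or decidable goals.  Every f_η is expanding, z < f_η(z), by transfinite
-- induction.  For a limit ν with fundamental sequence s, every value of f_α
-- with s x < α ≤ s (x+1) exceeds f_{s x}(1): Vf_α ⊆ Vf_t for t = s x + 1 and
-- min Vf_t = f_{s x}(f_{s x}(1)); iterating gives x < f_{s x}(1).  Hence each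
-- y leaves all ranges Vf_α with s y < α < ν (eventuallyOutside).
-- The theorem: the least upper bound ν of η′ is a limit, and some η′ n lies
-- above s y, so y ∉ Vf_{η′ n}.
module Submission where

open import Defs
open import Data.Nat using (ℕ; zero; suc; _+_; _^_; _≤_; _<_; _<?_; z≤n; s≤s)
open import Data.Nat.Properties
open import Data.Product using (∃-syntax; Σ; _×_; _,_; proj₁; proj₂)
open import Data.Sum using (_⊎_; inj₁; inj₂)
open import Data.Empty using (⊥-elim)
open import Relation.Nullary using (¬_; Dec; yes; no)
open import Relation.Nullary.Negation using (¬¬-map)
open import Relation.Nullary.Decidable using (decidable-stable; ¬¬-excluded-middle)
open import Relation.Binary.PropositionalEquality using (_≡_; refl; sym; subst)
open import Relation.Binary.Definitions using (Trichotomous; tri<; tri≈; tri>)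
open import Induction.WellFounded using (WellFounded; Acc; acc; wf⇒asym)

byClassical : {A G : Set} → Dec G → ¬ ¬ A → (A → G) → G
byClassical g a k = decidable-stable g (¬¬-map k a)

n<2^n : ∀ n → n < 2 ^ n
n<2^n zero = s≤s z≤n
n<2^n (suc n) = +-mono-≤ (m^n>0 2 n) (≤-trans (n<2^n n) (m≤m+n (2 ^ n) 0))

rangeMin : (f : ℕ → ℕ) → (∀ x y → 1 ≤ x → x < y → f x < f y) →
           ∀ {y} → Range f y → f 1 ≤ y
rangeMin f incr (suc zero , _ , refl) = ≤-refl
rangeMin f incr (suc (suc k) , _ , refl) = <⇒≤ (incr 1 (suc (suc k)) ≤-refl (s≤s (s≤s z≤n)))

module WellOrder {I : Set} (_≺_ : I → I → Set)
                 (tri : Trichotomous _≡_ _≺_) (wf : WellFounded _≺_) where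
  open Ord _≺_

  asym : ∀ {a b} → a ≺ b → ¬ (b ≺ a)
  asym = wf⇒asym wf

  irrefl : ∀ {a} → ¬ (a ≺ a)
  irrefl p = asym p p

  noThreeCycle : ∀ {a b c} → Acc _≺_ a → a ≺ b → b ≺ c → ¬ (c ≺ a)
  noThreeCycle (acc rs) p q r = noThreeCycle (rs r) r p q

  ≺-trans : ∀ {a b c} → a ≺ b → b ≺ c → a ≺ c
  ≺-trans {a} {b} {c} p q with tri a c
  ... | tri< a≺c _ _ = a≺c
  ... | tri≈ _ refl _ = ⊥-elim (asym p q)
  ... | tri> _ _ c≺a = ⊥-elim (noThreeCycle (wf a) p q c≺a)

  ≼-≺-trans : ∀ {a b c} → a ≼ b → b ≺ c → a ≺ c
  ≼-≺-trans (inj₁ p) q = ≺-trans p q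
  ≼-≺-trans (inj₂ refl) q = q

  ≺-≼-trans : ∀ {a b c} → a ≺ b → b ≼ c → a ≺ c
  ≺-≼-trans p (inj₁ q) = ≺-trans p q
  ≺-≼-trans p (inj₂ refl) = p

  ≼-if-not-≻ : ∀ {a b} → ¬ (b ≺ a) → a ≼ b
  ≼-if-not-≻ {a} {b} b⊀a with tri a b
  ... | tri< a≺b _ _ = inj₁ a≺b
  ... | tri≈ _ a≡b _ = inj₂ a≡b
  ... | tri> _ _ b≺a = ⊥-elim (b⊀a b≺a)

  IsLeast : (I → Set) → I → Set
  IsLeast Q β = Q β × (∀ γ → Q γ → β ≼ γ)

  leastWitness : (Q : I → Set) → ∀ b → Q b → ¬ ¬ (Σ I (IsLeast Q))
  leastWitness Q b = go b (wf b)
    where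
    go : ∀ b → Acc _≺_ b → Q b → ¬ ¬ (Σ I (IsLeast Q))
    go b (acc rs) qb k = ¬¬-excluded-middle {A = ∃[ γ ] (γ ≺ b × Q γ)} λ where
      (yes (γ , γ≺b , qγ)) → go γ (rs γ≺b) qγ k
      (no none) → k (b , qb , λ γ qγ → ≼-if-not-≻ (λ γ≺b → none (γ , γ≺b , qγ)))

  successor : ∀ {a b} → a ≺ b → ¬ ¬ (Σ I (IsSucc a))
  successor {a} {b} = leastWitness (a ≺_) b

  classify : ∀ η → ¬ ¬ (IsZero η ⊎ Σ I (λ α → IsSucc α η) ⊎ IsLimit η)
  classify η k = ¬¬-excluded-middle {A = IsZero η} λ where
    (yes isZero) → k (inj₁ isZero)
    (no nonzero) → ¬¬-excluded-middle {A = Σ I (λ α → IsSucc α η)} λ where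
      (yes succ) → k (inj₂ (inj₁ succ))
      (no nonsucc) → k (inj₂ (inj₂ (nonzero , λ α sα → nonsucc (α , sα))))

  monotone : (s : ℕ → I) → (∀ x → s x ≺ s (suc x)) → ∀ d i → s i ≼ s (d + i)
  monotone s incr zero i = inj₂ refl
  monotone s incr (suc d) i = inj₁ (≼-≺-trans (monotone s incr d i) (incr (d + i)))

  locate : (s : ℕ → I) → ∀ α d K → s K ≺ α → α ≺ s (d + K) →
           Σ ℕ λ x → K ≤ x × s x ≺ α × α ≼ s (suc x)
  locate s α zero K p q = ⊥-elim (asym p q)
  locate s α (suc d) K p q with tri α (s (suc K))
  ... | tri< α≺ _ _ = K , ≤-refl , p , inj₁ α≺
  ... | tri≈ _ α≡ _ = K , ≤-refl , p , inj₂ α≡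
  ... | tri> _ _ ≺α with locate s α d (suc K) ≺α (subst (λ k → α ≺ s k) (sym (+-suc d K)) q)
  ...   | x , K<x , inside = x , <⇒≤ K<x , inside

  UpperBound : (ℕ → I) → I → Set
  UpperBound η′ β = ∀ n → η′ n ≼ β

  module Supremum (η′ : ℕ → I) (incr : ∀ n → η′ n ≺ η′ (suc n))
                  (ν : I) (sup : IsLeast (UpperBound η′) ν) where

    below : ∀ n → η′ n ≺ ν
    below n = ≺-≼-trans (incr n) (proj₁ sup (suc n))

    exceeded : ∀ β → β ≺ ν → ¬ ¬ (∃[ n ] (β ≺ η′ n))
    exceeded β β≺ν none with proj₂ sup β (λ n → ≼-if-not-≻ (λ β≺ → none (n , β≺)))
    ... | ν≼β = irrefl (≼-≺-trans ν≼β β≺ν)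

    isLimit : IsLimit ν
    isLimit = (λ isZero → isZero (η′ 0) (below 0)) , notSucc
      where
      notSucc : ∀ α → ¬ IsSucc α ν
      notSucc α (α≺ν , ν-least) = exceeded α α≺ν λ where
        (n , α≺η′n) → irrefl (≼-≺-trans (ν-least (η′ n) α≺η′n) (below n))

module Growth (I : Set) (_≺_ : I → I → Set) (L : Ord.IsLimitOrdinalBelowΩ _≺_)
              (f : I → ℕ → ℕ) (P : Ord.Properties _≺_ f) where
  open Ord _≺_
  open WellOrder _≺_ (proj₁ L) (proj₁ (proj₂ L))

  positive : ∀ η z → 1 ≤ z → 1 ≤ f η z
  positive η = proj₁ (proj₁ P η)

  increasing : ∀ η x y → 1 ≤ x → x < y → f η x < f η y
  increasing η = proj₂ (proj₁ P η)

  atZero : ∀ η → IsZero η → ∀ x → 1 ≤ x → f η x ≡ 2 ^ x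
  atZero = proj₁ (proj₂ P)

  atSucc : ∀ η α → IsSucc α η → ∀ x → 1 ≤ x → f η x ≡ f α (f α x)
  atSucc = proj₁ (proj₂ (proj₂ P))

  LimitData : I → Set
  LimitData η = Σ (ℕ → I) λ s →
    IsFundSeq η s ×
    (∀ x t → IsSucc (s x) t → Arrow f t (s (suc x))) ×
    (∀ x → 1 ≤ x → f η x ≡ f (s x) 1)

  atLimit : ∀ η → IsLimit η → LimitData η
  atLimit = proj₂ (proj₂ (proj₂ P))

  module Interval (s : ℕ → I) (incr : ∀ x → s x ≺ s (suc x))
                  (arrows : ∀ x t → IsSucc (s x) t → Arrow f t (s (suc x)))
                  (expanding : ∀ x z → 1 ≤ z → z < f (s x) z) where

    aboveInterval : ∀ x α → s x ≺ α → α ≼ s (suc x) →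
                    ∀ {y} → Range (f α) y → f (s x) 1 < y
    aboveInterval x α sx≺α α≼ {y} y∈ =
      byClassical (f (s x) 1 <? y) (successor (incr x)) λ (t , st) →
        let c₁ = f (s x) 1
            c₁<ft1 : c₁ < f t 1
            c₁<ft1 = subst (c₁ <_) (sym (atSucc t (s x) st 1 ≤-refl))
                           (expanding x c₁ (positive (s x) 1 ≤-refl))
        in <-≤-trans c₁<ft1 (rangeMin (f t) (increasing t) (y∈ₜ t st))
      where
      y∈ₜ : ∀ t → IsSucc (s x) t → Range (f t) y
      y∈ₜ t st with proj₂ st α sx≺α
      ... | inj₂ refl = y∈
      ... | inj₁ t≺α = proj₂ (arrows x t st) α t≺α α≼ y y∈

    unbounded : ∀ x → x < f (s x) 1
    unbounded zero = positive (s 0) 1 ≤-refl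
    unbounded (suc x) = ≤-<-trans (unbounded x)
      (aboveInterval x (s (suc x)) (incr x) (inj₂ refl) (1 , ≤-refl , refl))

  expanding : ∀ η z → 1 ≤ z → z < f η z
  expanding η = go η (proj₁ (proj₂ L) η)
    where
    go : ∀ η → Acc _≺_ η → ∀ z → 1 ≤ z → z < f η z
    go η (acc rs) z 1≤z = byClassical (z <? f η z) (classify η) byKind
      where
      byKind : IsZero η ⊎ Σ I (λ α → IsSucc α η) ⊎ IsLimit η → z < f η z
      byKind (inj₁ zeroη) = subst (z <_) (sym (atZero η zeroη z 1≤z)) (n<2^n z)
      byKind (inj₂ (inj₁ (α , sα))) =
        subst (z <_) (sym (atSucc η α sα z 1≤z)) (<-trans z<fαz fαz<fαfαz)
        where
        z<fαz : z < f α z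
        z<fαz = go α (rs (proj₁ sα)) z 1≤z
        fαz<fαfαz : f α z < f α (f α z)
        fαz<fαfαz = go α (rs (proj₁ sα)) (f α z) (positive α z 1≤z)
      byKind (inj₂ (inj₂ limη)) with atLimit η limη
      ... | s , (incr , below , _) , arrows , value =
        subst (z <_) (sym (value z 1≤z))
          (Interval.unbounded s incr arrows (λ x → go (s x) (rs (below x))) z)

  eventuallyOutside : ∀ ν → IsLimit ν → ∀ y →
                      ∃[ β ] (β ≺ ν × (∀ α → β ≺ α → α ≺ ν → ¬ Range (f α) y))
  eventuallyOutside ν limν y with atLimit ν limν
  ... | s , (incr , below , cofinal) , arrows , _ = s y , below y , outside
    where
    open Interval s incr arrows (λ x → expanding (s x))
    outside : ∀ α → s y ≺ α → α ≺ ν → ¬ Range (f α) y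
    outside α sy≺α α≺ν y∈ =
      let (m , α≺sm) = cofinal α α≺ν
          α≺sm+y = subst (λ k → α ≺ s k) (+-comm y m)
                         (≺-≼-trans α≺sm (monotone s incr y m))
          (x , y≤x , sx≺α , α≼) = locate s α m y sy≺α α≺sm+y
      in <-irrefl refl (≤-<-trans y≤x
           (<-trans (unbounded x) (aboveInterval x α sx≺α α≼ y∈)))

theorem1 : (I : Set) (_≺_ : I → I → Set) → Ord.IsLimitOrdinalBelowΩ _≺_ →
    (f : I → ℕ → ℕ) → Ord.Properties _≺_ f →
    (η′ : ℕ → I) → (∀ n → η′ n ≺ η′ (suc n)) →
    (∃[ μ ] (∀ n → Ord._≼_ _≺_ (η′ n) μ)) →
    ¬ (∃[ y ] (∀ n → Range (f (η′ n)) y))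
theorem1 I _≺_ L f P η′ incr (μ , bounded) (y , y∈) =
  leastWitness (UpperBound η′) μ bounded λ (ν , sup) →
    let open Supremum η′ incr ν sup
        (β , β≺ν , outside) = eventuallyOutside ν isLimit y
    in exceeded β β≺ν λ (n , β≺η′n) → outside (η′ n) β≺η′n (below n) (y∈ n)
  where
  open WellOrder _≺_ (proj₁ L) (proj₁ (proj₂ L))
  open Growth I _≺_ L f P
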